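{- Let $S$ be a finite set, let $S_1,\dots,S_n\subseteq S$, and let $k\ge 2$ be an integer. For a partition of $\{S_1,\dots,S_n\}$ into $k$ covers $c_1,\dots,c_k$, define its coverage as $\sum_{i=1}^k \left|\bigcup_{S_j\in c_i} S_j\right|$, and let $\mathrm{OPT}$ be the maximum coverage over all such partitions. Consider the centralized greedy algorithm: starting with all covers empty, for $j=1,2,\dots,n$ in order, for each $v\in S_j$ let $y_v$ be the number of subsets among $S_j,S_{j+1},\dots,S_n$ that contain $v$ (the subsets containing $v$ not yet assigned, including $S_j$), and assign $S_j$ to a cover $c_i$ maximizing $$\sum_{v\in S_j,\ v\notin \bigcup_{S_{j'}\in c_i} S_{j'}} \left(1-\frac{1}{k}\right)^{y_v-1},$$ where the union is over subsets already assigned to $c_i$ (ties broken arbitrarily). Then the coverage of the resulting partition is at least $\left(1-\frac{1}{e}\right)\mathrm{OPT}$.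
   Context: This is the SET K-COVER problem: given $S$, the collection $\{S_j\}_{j=1}^n$ and $k$, find a partition of the subsets into $k$ covers maximizing $\sum_{i=1}^k |\bigcup_{S_j\in c_i} S_j|$. -}

module Defs where

open import Data.Nat using (ℕ; zero; suc; _+_; _*_; _∸_; _^_; _≤_; _<_)
open import Data.Fin using (Fin; _≟_; _<?_; _≤?_)
open import Data.Fin.Subset using (Subset; _∈_; _∉_; ⋃; ∣_∣)
open import Data.Fin.Subset.Properties using (_∈?_)
open import Data.List using (List; filter; map; length; allFin; foldr)
open import Data.Nat.ListAction using (sum)
open import Data.Integer using (+_)
open import Data.Rational.Unnormalised using (ℚᵘ; mkℚᵘ; 0ℚᵘ; 1ℚᵘ) renaming (_+_ to _+ℚ_; _*_ to _*ℚ_)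
open import Relation.Nullary using (¬?)
open import Relation.Nullary.Decidable using (_×-dec_)

-- A partition of {S_1..S_n} into k covers = an assignment  a : Fin n → Fin k
-- (S_j is put in cover c_{a j}; covers may be empty).

coverUnion : ∀ {m n k} → (Fin n → Subset m) → (Fin n → Fin k) → Fin k → Subset m
coverUnion {n = n} Ss a i = ⋃ (map Ss (filter (λ j → a j ≟ i) (allFin n)))

coverage : ∀ {m n k} → (Fin n → Subset m) → (Fin n → Fin k) → ℕ
coverage {k = k} Ss a = sum (map (λ i → ∣ coverUnion Ss a i ∣) (allFin k))

partialCoverUnion : ∀ {m n k} → (Fin n → Subset m) → (Fin n → Fin k) → Fin n → Fin k → Subset m
partialCoverUnion {n = n} Ss a j i =
  ⋃ (map Ss (filter (λ j' → (j' <? j) ×-dec (a j' ≟ i)) (allFin n)))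

yv : ∀ {m n} → (Fin n → Subset m) → Fin n → Fin m → ℕ
yv {n = n} Ss j v = length (filter (λ j' → (j ≤? j') ×-dec (v ∈? Ss j')) (allFin n))

_^ℚ_ : ℚᵘ → ℕ → ℚᵘ
x ^ℚ zero  = 1ℚᵘ
x ^ℚ suc e = x *ℚ (x ^ℚ e)

-- 1 - 1/k  =  (k-1)/k   (for k ≥ 1; denominator of mkℚᵘ p d is suc d)
oneMinusInv : ℕ → ℚᵘ
oneMinusInv k = mkℚᵘ (+ (k ∸ 1)) (k ∸ 1)

sumℚ : List ℚᵘ → ℚᵘ
sumℚ = foldr _+ℚ_ 0ℚᵘ

greedyGain : ∀ {m n} (k : ℕ) → (Fin n → Subset m) → (Fin n → Fin k) → Fin n → Fin k → ℚᵘ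
greedyGain {m = m} k Ss a j i =
  sumℚ (map (λ v → oneMinusInv k ^ℚ (yv Ss j v ∸ 1))
            (filter (λ v → (v ∈? Ss j) ×-dec ¬? (v ∈? partialCoverUnion Ss a j i)) (allFin m)))

-- a is a possible outcome of the centralized greedy algorithm (ties broken arbitrarily):
-- at every step j, the chosen cover a j maximizes the greedy score, given the earlier choices.
IsGreedyOutcome : ∀ {m n} (k : ℕ) → (Fin n → Subset m) → (Fin n → Fin k) → Set
IsGreedyOutcome k Ss a =
  ∀ j i → greedyGain k Ss a j i Data.Rational.Unnormalised.≤ greedyGain k Ss a j (a j)

-- Since (N/(N+1))^N decreases to 1/e  (e = lim (1+1/N)^N), the constant 1 - 1/e is the
-- supremum of 1 - (N/(N+1))^N, so  x ≥ (1-1/e) y  iff  for all N,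
-- (N+1)^N · x ≥ ((N+1)^N - N^N) · y.
AtLeastOneMinusInvETimes : ℕ → ℕ → Set
AtLeastOneMinusInvETimes x y =
  ∀ (N : ℕ) → ((suc N) ^ N ∸ N ^ N) * y ≤ (suc N) ^ N * x

-- Derandomisation by conditional expectations. If every S_j is put into a uniformly random cover,
-- an element v lying in d_v of the sets lies on average in k (1 - (1 - 1/k)^d_v) covers. Once the
-- first t sets are placed, let E_t be the expected number of pairs (v , i) with v ∉ c_i at the end
-- when the remaining sets are placed at random. Placing the next set into cover i changes E_t by a
-- positive multiple of (average greedy score - score of i), so the greedy choice never increases
-- E_t, and the greedy coverage is at least the random one, Σ_v k (1 - (1 - 1/k)^d_v).
-- Any partition covers v at most min (k , d_v) times; concavity of d ↦ 1 - (1 - 1/k)^d gives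
-- min (k , d) (1 - (1 - 1/k)^k) ≤ k (1 - (1 - 1/k)^d), and (1 - 1/k)^k ≤ (N/(N+1))^N for every N
-- since (1 + 1/N)^N increases and (1 + 1/n)^(n+1) decreases. All quantities are scaled by powers
-- of k to stay in ℕ.
module Submission where

open import Level using (Level)
open import Data.Nat
open import Data.Nat.Properties
open import Data.Nat.Tactic.RingSolver using (solve-∀)
open import Data.Nat.ListAction using () renaming (sum to sumᴸ)
open import Data.Integer as ℤ using (+≤+)
import Data.Integer.Properties as ℤ
open import Data.Rational.Unnormalised as ℚ using (ℚᵘ; mkℚᵘ; _≃_; *≡*; *≤*)
import Data.Rational.Unnormalised.Properties as ℚ
open import Data.Fin as Fin using (Fin; zero; suc; toℕ; fromℕ<; punchIn)
import Data.Fin.Properties as Fin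
open import Data.Fin.Subset using (Subset; _∈_; _∉_; ⋃; ∣_∣; inside; outside)
open import Data.Fin.Subset.Properties using (_∈?_; x∈p∪q⁻; x∈p∪q⁺; ∉⊥; drop-there)
open import Data.List using (List; []; _∷_; map; filter; allFin; length; tabulate)
open import Data.List.Properties using (map-tabulate)
open import Data.Vec using ([]; _∷_; there)
open import Data.Empty using (⊥-elim)
open import Data.Product using (_×_; _,_; proj₂)
open import Data.Sum using (_⊎_; inj₁; inj₂; [_,_])
open import Function using (_∘_; id; _⇔_; mk⇔; Equivalence)
open import Relation.Binary.PropositionalEquality
  using (_≡_; refl; sym; trans; cong; cong₂; subst; subst₂; module ≡-Reasoning)
open import Relation.Nullary using (Dec; yes; no; ¬_; ¬?)
open import Relation.Nullary.Decidable using (_×-dec_)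
open import Relation.Unary using (Pred; Decidable)
open import Algebra.Bundles using (CommutativeMonoid)
open import Algebra.Properties.CommutativeSemigroup
  (CommutativeMonoid.commutativeSemigroup ℚ.*-1-commutativeMonoid)
  using () renaming (interchange to ℚ-*-interchange)
open import Algebra.Properties.Semiring.Sum +-*-semiring
  using (sum; sum-syntax; sum-cong-≗; ∑-distrib-+; ∑-comm; *-distribˡ-sum; *-distribʳ-sum;
         sum-remove; sum-replicate-zero)
open import Defs

private
  variable
    ℓ ℓ′ ℓ″ : Level
    P : Set ℓ
    Q : Set ℓ′
    R : Set ℓ″

-- Indicators and finite sums

𝟙 : Dec P → ℕ
𝟙 (yes _) = 1
𝟙 (no _)  = 0

𝟙≤1 : (P? : Dec P) → 𝟙 P? ≤ 1
𝟙≤1 (yes _) = ≤-refl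
𝟙≤1 (no _)  = z≤n

𝟙-yes : (P? : Dec P) → P → 𝟙 P? ≡ 1
𝟙-yes (yes _) _ = refl
𝟙-yes (no ¬p) p = ⊥-elim (¬p p)

𝟙-no : (P? : Dec P) → ¬ P → 𝟙 P? ≡ 0
𝟙-no (yes p) ¬p = ⊥-elim (¬p p)
𝟙-no (no _)  _  = refl

𝟙-cong : (P? : Dec P) (Q? : Dec Q) → P ⇔ Q → 𝟙 P? ≡ 𝟙 Q?
𝟙-cong (yes p) Q? P⇔Q = sym (𝟙-yes Q? (Equivalence.to P⇔Q p))
𝟙-cong (no ¬p) Q? P⇔Q = sym (𝟙-no Q? (¬p ∘ Equivalence.from P⇔Q))

𝟙-× : (P? : Dec P) (Q? : Dec Q) → 𝟙 (P? ×-dec Q?) ≡ 𝟙 P? * 𝟙 Q?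
𝟙-× (yes _) (yes _) = refl
𝟙-× (yes _) (no _)  = refl
𝟙-× (no _)  _       = refl

𝟙-+-𝟙-¬ : (P? : Dec P) → 𝟙 P? + 𝟙 (¬? P?) ≡ 1
𝟙-+-𝟙-¬ (yes _) = refl
𝟙-+-𝟙-¬ (no _)  = refl

𝟙-⊎ : (P? : Dec P) (Q? : Dec Q) (R? : Dec R) → P ⇔ (Q ⊎ R) → ¬ (Q × R) → 𝟙 P? ≡ 𝟙 Q? + 𝟙 R?
𝟙-⊎ P? (yes q) (yes r) _ disjoint = ⊥-elim (disjoint (q , r))
𝟙-⊎ P? (yes q) (no _)  P⇔Q⊎R _ = trans (𝟙-yes P? (Equivalence.from P⇔Q⊎R (inj₁ q))) (sym (+-identityʳ 1))
𝟙-⊎ P? (no _)  (yes r) P⇔Q⊎R _ = 𝟙-yes P? (Equivalence.from P⇔Q⊎R (inj₂ r))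
𝟙-⊎ P? (no ¬q) (no ¬r) P⇔Q⊎R _ = 𝟙-no P? ([ ¬q , ¬r ] ∘ Equivalence.to P⇔Q⊎R)

𝟙[b+c≡0]+b*𝟙[c≡0] : ∀ b c → b ≤ 1 → 𝟙 (b + c ≟ 0) + b * 𝟙 (c ≟ 0) ≡ 𝟙 (c ≟ 0)
𝟙[b+c≡0]+b*𝟙[c≡0] 0 c _          = +-identityʳ (𝟙 (c ≟ 0))
𝟙[b+c≡0]+b*𝟙[c≡0] 1 c _          = +-identityʳ (𝟙 (c ≟ 0))
𝟙[b+c≡0]+b*𝟙[c≡0] (2+ _) c (s≤s ())

^𝟙*suc^𝟙¬+𝟙 : ∀ q (P? : Dec P) → q ^ 𝟙 P? * suc q ^ 𝟙 (¬? P?) + 𝟙 P? ≡ suc q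
^𝟙*suc^𝟙¬+𝟙 q (yes _) = trans (cong (_+ 1) (trans (*-identityʳ (q * 1)) (*-identityʳ q))) (+-comm q 1)
^𝟙*suc^𝟙¬+𝟙 q (no _)  = trans (+-identityʳ _) (trans (*-identityˡ (suc q * 1)) (*-identityʳ (suc q)))

sum-mono-≤ : ∀ {n} {f g : Fin n → ℕ} → (∀ i → f i ≤ g i) → sum f ≤ sum g
sum-mono-≤ {zero}  f≤g = z≤n
sum-mono-≤ {suc n} f≤g = +-mono-≤ (f≤g zero) (sum-mono-≤ (f≤g ∘ suc))

sum-const : ∀ n c → ∑[ i < n ] c ≡ n * c
sum-const zero    c = refl
sum-const (suc n) c = cong (c +_) (sum-const n c)

sum-δ : ∀ {n} (i : Fin n) (f : Fin n → ℕ) → ∑[ j < n ] (𝟙 (i Fin.≟ j) * f j) ≡ f i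
sum-δ {suc n} i f = begin
  ∑[ j < suc n ] (𝟙 (i Fin.≟ j) * f j)
    ≡⟨ sum-remove {i = i} (λ j → 𝟙 (i Fin.≟ j) * f j) ⟩
  𝟙 (i Fin.≟ i) * f i + ∑[ j < n ] (𝟙 (i Fin.≟ punchIn i j) * f (punchIn i j))
    ≡⟨ cong₂ _+_ (cong (_* f i) (𝟙-yes (i Fin.≟ i) refl))
                 (trans (sum-cong-≗ off-diagonal) (sum-replicate-zero n)) ⟩
  1 * f i + 0
    ≡⟨ trans (+-identityʳ (1 * f i)) (*-identityˡ (f i)) ⟩
  f i
    ∎
  where
  open ≡-Reasoning
  off-diagonal : ∀ j → 𝟙 (i Fin.≟ punchIn i j) * f (punchIn i j) ≡ 0
  off-diagonal j = cong (_* f (punchIn i j)) (𝟙-no (i Fin.≟ punchIn i j) (Fin.punchInᵢ≢i i j ∘ sym))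

sumᴸ-allFin : ∀ {n} (f : Fin n → ℕ) → sumᴸ (map f (allFin n)) ≡ sum f
sumᴸ-allFin {n} f = trans (cong sumᴸ (map-tabulate id f)) (sumᴸ-tabulate f)
  where
  sumᴸ-tabulate : ∀ {n} (f : Fin n → ℕ) → sumᴸ (tabulate f) ≡ sum f
  sumᴸ-tabulate {zero}  f = refl
  sumᴸ-tabulate {suc n} f = cong (f zero +_) (sumᴸ-tabulate (f ∘ suc))

length-filter≡sum𝟙 : ∀ {A : Set ℓ} {P : Pred A ℓ′} (P? : Decidable P) xs →
  length (filter P? xs) ≡ sumᴸ (map (𝟙 ∘ P?) xs)
length-filter≡sum𝟙 P? []       = refl
length-filter≡sum𝟙 P? (x ∷ xs) with P? x
... | yes _ = cong suc (length-filter≡sum𝟙 P? xs)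
... | no _  = length-filter≡sum𝟙 P? xs

𝟙∈≡𝟙suc∈∷ : ∀ {m} x (p : Subset m) v → 𝟙 (v ∈? p) ≡ 𝟙 (suc v ∈? x ∷ p)
𝟙∈≡𝟙suc∈∷ x p v = 𝟙-cong (v ∈? p) (suc v ∈? x ∷ p) (mk⇔ there drop-there)

∣p∣≡sum𝟙∈ : ∀ {m} (p : Subset m) → ∣ p ∣ ≡ ∑[ v < m ] 𝟙 (v ∈? p)
∣p∣≡sum𝟙∈ []            = refl
∣p∣≡sum𝟙∈ (inside ∷ p)  = cong suc (trans (∣p∣≡sum𝟙∈ p) (sum-cong-≗ (𝟙∈≡𝟙suc∈∷ inside p)))
∣p∣≡sum𝟙∈ (outside ∷ p) = trans (∣p∣≡sum𝟙∈ p) (sum-cong-≗ (𝟙∈≡𝟙suc∈∷ outside p))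

sum-𝟙-split : ∀ {n} (i : Fin n) {P : Pred (Fin n) ℓ} {Q : Pred (Fin n) ℓ′}
  (P? : Decidable P) (Q? : Decidable Q) →
  (∀ j → P j ⇔ (i ≡ j ⊎ Q j)) → ¬ Q i → (f : Fin n → ℕ) →
  ∑[ j < n ] (𝟙 (P? j) * f j) ≡ f i + ∑[ j < n ] (𝟙 (Q? j) * f j)
sum-𝟙-split {n = n} i P? Q? P⇔i≡⊎Q ¬Qi f = begin
  ∑[ j < n ] (𝟙 (P? j) * f j)
    ≡⟨ sum-cong-≗ split ⟩
  ∑[ j < n ] (𝟙 (i Fin.≟ j) * f j + 𝟙 (Q? j) * f j)
    ≡⟨ ∑-distrib-+ (λ j → 𝟙 (i Fin.≟ j) * f j) (λ j → 𝟙 (Q? j) * f j) ⟩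
  ∑[ j < n ] (𝟙 (i Fin.≟ j) * f j) + ∑[ j < n ] (𝟙 (Q? j) * f j)
    ≡⟨ cong (_+ ∑[ j < n ] (𝟙 (Q? j) * f j)) (sum-δ i f) ⟩
  f i + ∑[ j < n ] (𝟙 (Q? j) * f j)
    ∎
  where
  open ≡-Reasoning
  split : ∀ j → 𝟙 (P? j) * f j ≡ 𝟙 (i Fin.≟ j) * f j + 𝟙 (Q? j) * f j
  split j = trans (cong (_* f j) (𝟙-⊎ (P? j) (i Fin.≟ j) (Q? j) (P⇔i≡⊎Q j) λ { (refl , Qi) → ¬Qi Qi }))
                  (*-distribʳ-+ (f j) (𝟙 (i Fin.≟ j)) (𝟙 (Q? j)))

module _ {n : ℕ} where

  sum≥ : ℕ → (Fin n → ℕ) → ℕ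
  sum≥ t f = ∑[ j < n ] (𝟙 (t ≤? toℕ j) * f j)

  sum< : ℕ → (Fin n → ℕ) → ℕ
  sum< t f = ∑[ j < n ] (𝟙 (toℕ j <? t) * f j)

  sum≥-split : ∀ i f → sum≥ (toℕ i) f ≡ f i + sum≥ (suc (toℕ i)) f
  sum≥-split i = sum-𝟙-split i (λ j → toℕ i ≤? toℕ j) (λ j → suc (toℕ i) ≤? toℕ j)
    (λ j → mk⇔ ([ inj₂ , inj₁ ∘ Fin.toℕ-injective ] ∘ m≤n⇒m<n∨m≡n) [ ≤-reflexive ∘ cong toℕ , <⇒≤ ])
    (<-irrefl refl)

  sum<-split : ∀ i f → sum< (suc (toℕ i)) f ≡ f i + sum< (toℕ i) f
  sum<-split i = sum-𝟙-split i (λ j → toℕ j <? suc (toℕ i)) (λ j → toℕ j <? toℕ i)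
    (λ j → mk⇔ ([ inj₂ , inj₁ ∘ sym ∘ Fin.toℕ-injective ] ∘ m<1+n⇒m<n∨m≡n)
               [ s≤s ∘ ≤-reflexive ∘ cong toℕ ∘ sym , m<n⇒m<1+n ])
    (<-irrefl refl)

  sum≥-zero : (f : Fin n → ℕ) → sum≥ 0 f ≡ sum f
  sum≥-zero f = sum-cong-≗ (λ j → *-identityˡ (f j))

  sum≥-n : (f : Fin n → ℕ) → sum≥ n f ≡ 0
  sum≥-n f = trans (sum-cong-≗ (λ j → cong (_* f j) (𝟙-no (n ≤? toℕ j) (<⇒≱ (Fin.toℕ<n j)))))
                   (sum-replicate-zero n)

  sum<-zero : (f : Fin n → ℕ) → sum< 0 f ≡ 0
  sum<-zero f = sum-replicate-zero n

  sum<-n : (f : Fin n → ℕ) → sum< n f ≡ sum f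
  sum<-n f = sum-cong-≗ (λ j → trans (cong (_* f j) (𝟙-yes (toℕ j <? n) (Fin.toℕ<n j))) (*-identityˡ (f j)))

∑∑-distrib-+ : ∀ {m n} (f g : Fin m → Fin n → ℕ) →
  ∑[ x < m ] ∑[ y < n ] (f x y + g x y) ≡ ∑[ x < m ] ∑[ y < n ] f x y + ∑[ x < m ] ∑[ y < n ] g x y
∑∑-distrib-+ f g =
  trans (sum-cong-≗ (λ x → ∑-distrib-+ (f x) (g x))) (∑-distrib-+ (λ x → sum (f x)) (λ x → sum (g x)))

*-distribˡ-∑∑ : ∀ {m n} c (f : Fin m → Fin n → ℕ) →
  c * ∑[ x < m ] ∑[ y < n ] f x y ≡ ∑[ x < m ] ∑[ y < n ] (c * f x y)
*-distribˡ-∑∑ c f = trans (*-distribˡ-sum c (λ x → sum (f x))) (sum-cong-≗ (λ x → *-distribˡ-sum c (f x)))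

≤-by-averaging : ∀ {k} x y z (f : Fin k → ℕ) → k * (x + y) ≡ z + sum f → (∀ i → f i ≤ y) → k * x ≤ z
≤-by-averaging {k} x y z f eq f≤y = +-cancelʳ-≤ (k * y) (k * x) z (begin
  k * x + k * y     ≡⟨ *-distribˡ-+ k x y ⟨
  k * (x + y)       ≡⟨ eq ⟩
  z + sum f         ≤⟨ +-monoʳ-≤ z (sum-mono-≤ f≤y) ⟩
  z + ∑[ i < k ] y  ≡⟨ cong (z +_) (sum-const k y) ⟩
  z + k * y         ∎)
  where open ≤-Reasoning

pow-contraction : ∀ k (Φ : ℕ → ℕ) n → (∀ t → t < n → k * Φ (suc t) ≤ Φ t) → k ^ n * Φ n ≤ Φ 0
pow-contraction k Φ zero    _        = ≤-reflexive (+-identityʳ (Φ 0))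
pow-contraction k Φ (suc n) contract = begin
  k * k ^ n * Φ (suc n)   ≡⟨ rotate k (k ^ n) (Φ (suc n)) ⟩
  k ^ n * (k * Φ (suc n)) ≤⟨ *-monoʳ-≤ (k ^ n) (contract n ≤-refl) ⟩
  k ^ n * Φ n             ≤⟨ pow-contraction k Φ n (λ t t<n → contract t (m<n⇒m<1+n t<n)) ⟩
  Φ 0                     ∎
  where
  open ≤-Reasoning
  rotate : ∀ a b c → a * b * c ≡ b * (a * c)
  rotate = solve-∀

-- Elements of a union of selected sets

module _ {m n} (Ss : Fin n → Subset m) {P : Pred (Fin n) ℓ} (P? : Decidable P) (v : Fin m) where

  multiplicityᴸ : List (Fin n) → ℕ
  multiplicityᴸ xs = sumᴸ (map (λ j → 𝟙 (P? j) * 𝟙 (v ∈? Ss j)) xs)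

  ∈⋃-filter⇔0<multiplicityᴸ : ∀ xs → v ∈ ⋃ (map Ss (filter P? xs)) ⇔ 0 < multiplicityᴸ xs
  ∈⋃-filter⇔0<multiplicityᴸ xs = mk⇔ (to xs) (from xs)
    where
    to : ∀ xs → v ∈ ⋃ (map Ss (filter P? xs)) → 0 < multiplicityᴸ xs
    to []       v∈∅ = ⊥-elim (∉⊥ v∈∅)
    to (x ∷ xs) v∈ with P? x
    ... | no _  = to xs v∈
    ... | yes _ with v ∈? Ss x | x∈p∪q⁻ (Ss x) (⋃ (map Ss (filter P? xs))) v∈
    ...   | yes _ | _           = s≤s z≤n
    ...   | no v∉ | inj₁ v∈x    = ⊥-elim (v∉ v∈x)
    ...   | no _  | inj₂ v∈rest = to xs v∈rest
    from : ∀ xs → 0 < multiplicityᴸ xs → v ∈ ⋃ (map Ss (filter P? xs))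
    from (x ∷ xs) 0<mult with P? x
    ... | no _  = from xs 0<mult
    ... | yes _ with v ∈? Ss x
    ...   | yes v∈x = x∈p∪q⁺ (inj₁ v∈x)
    ...   | no _    = x∈p∪q⁺ {p = Ss x} (inj₂ (from xs 0<mult))

  multiplicity : ℕ
  multiplicity = ∑[ j < n ] (𝟙 (P? j) * 𝟙 (v ∈? Ss j))

  ∈⋃-filter⇔0<multiplicity : v ∈ ⋃ (map Ss (filter P? (allFin n))) ⇔ 0 < multiplicity
  ∈⋃-filter⇔0<multiplicity =
    subst (λ c → v ∈ ⋃ (map Ss (filter P? (allFin n))) ⇔ 0 < c)
          (sumᴸ-allFin (λ j → 𝟙 (P? j) * 𝟙 (v ∈? Ss j))) (∈⋃-filter⇔0<multiplicityᴸ (allFin n))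

  𝟙∈⋃-filter≤multiplicity : 𝟙 (v ∈? ⋃ (map Ss (filter P? (allFin n)))) ≤ multiplicity
  𝟙∈⋃-filter≤multiplicity with v ∈? ⋃ (map Ss (filter P? (allFin n)))
  ... | yes v∈ = Equivalence.to ∈⋃-filter⇔0<multiplicity v∈
  ... | no _   = z≤n

  𝟙∉⋃-filter≡𝟙multiplicity≡0 : 𝟙 (¬? (v ∈? ⋃ (map Ss (filter P? (allFin n))))) ≡ 𝟙 (multiplicity ≟ 0)
  𝟙∉⋃-filter≡𝟙multiplicity≡0 = 𝟙-cong _ (multiplicity ≟ 0)
    (mk⇔ (λ v∉ → n≤0⇒n≡0 (≮⇒≥ (v∉ ∘ Equivalence.from ∈⋃-filter⇔0<multiplicity)))
         (λ mult≡0 v∈ → <⇒≢ (Equivalence.to ∈⋃-filter⇔0<multiplicity v∈) (sym mult≡0)))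

-- Powers of q/(q+1) and the constant 1 - 1/e

-- powGap q c = (q + 1)^c - q^c = Σ_{i<c} q^i (q + 1)^(c-1-i).
powGap : ℕ → ℕ → ℕ
powGap q zero    = 0
powGap q (suc c) = q ^ c + suc q * powGap q c

suc^≡^+powGap : ∀ q c → suc q ^ c ≡ q ^ c + powGap q c
suc^≡^+powGap q zero    = refl
suc^≡^+powGap q (suc c) = begin
  suc q * suc q ^ c                    ≡⟨ cong (suc q *_) (suc^≡^+powGap q c) ⟩
  suc q * (q ^ c + powGap q c)         ≡⟨ shuffle q (q ^ c) (powGap q c) ⟩
  q * q ^ c + (q ^ c + suc q * powGap q c) ∎
  where
  open ≡-Reasoning
  shuffle : ∀ q x y → suc q * (x + y) ≡ q * x + (x + suc q * y)
  shuffle = solve-∀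

powGap-one : ∀ q → powGap q 1 ≡ 1
powGap-one q = cong suc (*-zeroʳ (suc q))

powGap-lower : ∀ q c → suc c * q ^ c ≤ powGap q (suc c)
powGap-lower q zero    = ≤-reflexive (sym (powGap-one q))
powGap-lower q (suc c) = begin
  suc (suc c) * (q * q ^ c)            ≡⟨ shuffle q c (q ^ c) ⟩
  q * q ^ c + q * (suc c * q ^ c)      ≤⟨ +-monoʳ-≤ (q * q ^ c) (*-mono-≤ (n≤1+n q) (powGap-lower q c)) ⟩
  q * q ^ c + suc q * powGap q (suc c) ∎
  where
  open ≤-Reasoning
  shuffle : ∀ q c x → suc (suc c) * (q * x) ≡ q * x + q * (suc c * x)
  shuffle = solve-∀

powGap-upper : ∀ q c → powGap q (suc c) ≤ suc c * suc q ^ c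
powGap-upper q zero    = ≤-reflexive (powGap-one q)
powGap-upper q (suc c) = begin
  q * q ^ c + suc q * powGap q (suc c)       ≤⟨ +-mono-≤ (*-mono-≤ (n≤1+n q) (^-monoˡ-≤ c (n≤1+n q)))
                                                          (*-monoʳ-≤ (suc q) (powGap-upper q c)) ⟩
  suc q * suc q ^ c + suc q * (suc c * suc q ^ c) ≡⟨ shuffle (suc q) c (suc q ^ c) ⟩
  suc (suc c) * (suc q * suc q ^ c)          ∎
  where
  open ≤-Reasoning
  shuffle : ∀ k c x → k * x + k * (suc c * x) ≡ suc (suc c) * (k * x)
  shuffle = solve-∀

*-pow≤powGap*suc : ∀ q c → c * q ^ c ≤ powGap q c * suc q
*-pow≤powGap*suc q c = +-cancelˡ-≤ (q ^ c) _ _ (begin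
  q ^ c + c * q ^ c      ≡⟨⟩
  suc c * q ^ c          ≤⟨ powGap-lower q c ⟩
  q ^ c + suc q * powGap q c ≡⟨ cong (q ^ c +_) (*-comm (suc q) (powGap q c)) ⟩
  q ^ c + powGap q c * suc q ∎)
  where open ≤-Reasoning

^*powGap≤powGap-+ : ∀ q r c → suc q ^ r * powGap q c ≤ powGap q (r + c)
^*powGap≤powGap-+ q zero    c = ≤-reflexive (+-identityʳ (powGap q c))
^*powGap≤powGap-+ q (suc r) c = begin
  suc q * suc q ^ r * powGap q c         ≡⟨ *-assoc (suc q) (suc q ^ r) (powGap q c) ⟩
  suc q * (suc q ^ r * powGap q c)       ≤⟨ *-monoʳ-≤ (suc q) (^*powGap≤powGap-+ q r c) ⟩
  suc q * powGap q (r + c)               ≤⟨ m≤n+m _ (q ^ (r + c)) ⟩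
  q ^ (r + c) + suc q * powGap q (r + c) ∎
  where open ≤-Reasoning

powGap-average : ∀ q r c → c * powGap q (r + c) ≤ (r + c) * powGap q c * suc q ^ r
powGap-average q zero    c = ≤-reflexive (sym (*-identityʳ _))
powGap-average q (suc r) c = begin
  c * (q ^ (r + c) + suc q * powGap q (r + c))
    ≡⟨ distrib c (q ^ (r + c)) (suc q) (powGap q (r + c)) ⟩
  c * q ^ (r + c) + suc q * (c * powGap q (r + c))
    ≤⟨ +-mono-≤ first (*-monoʳ-≤ (suc q) (powGap-average q r c)) ⟩
  powGap q c * suc q * suc q ^ r + suc q * ((r + c) * powGap q c * suc q ^ r)
    ≡⟨ collect (r + c) (powGap q c) (suc q) (suc q ^ r) ⟩
  suc (r + c) * powGap q c * (suc q * suc q ^ r)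
    ∎
  where
  open ≤-Reasoning
  distrib : ∀ c x k y → c * (x + k * y) ≡ c * x + k * (c * y)
  distrib = solve-∀
  collect : ∀ s g k x → g * k * x + k * (s * g * x) ≡ suc s * g * (k * x)
  collect = solve-∀
  first : c * q ^ (r + c) ≤ powGap q c * suc q * suc q ^ r
  first = begin
    c * q ^ (r + c)           ≡⟨ cong (c *_) (trans (cong (q ^_) (+-comm r c)) (^-distribˡ-+-* q c r)) ⟩
    c * (q ^ c * q ^ r)       ≡⟨ *-assoc c (q ^ c) (q ^ r) ⟨
    c * q ^ c * q ^ r         ≤⟨ *-mono-≤ (*-pow≤powGap*suc q c) (^-monoˡ-≤ r (n≤1+n q)) ⟩
    powGap q c * suc q * suc q ^ r ∎

^-distrib-* : ∀ x y n → (x * y) ^ n ≡ x ^ n * y ^ n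
^-distrib-* x y zero    = refl
^-distrib-* x y (suc n) = trans (cong (x * y *_) (^-distrib-* x y n)) (interchange x y (x ^ n) (y ^ n))
  where
  interchange : ∀ x y u w → x * y * (u * w) ≡ x * u * (y * w)
  interchange = solve-∀

infix 4 _≤ᶠ_

_≤ᶠ_ : ℕ × ℕ → ℕ × ℕ → Set
(x , y) ≤ᶠ (x′ , y′) = x * y′ ≤ x′ * y

≤ᶠ-trans : ∀ u v w → 0 < proj₂ v → u ≤ᶠ v → v ≤ᶠ w → u ≤ᶠ w
≤ᶠ-trans (x₁ , y₁) (x₂ , y₂) (x₃ , y₃) y₂>0 u≤v v≤w =
  *-cancelʳ-≤ (x₁ * y₃) (x₃ * y₁) y₂ {{>-nonZero y₂>0}} (begin
    x₁ * y₃ * y₂ ≡⟨ swap x₁ y₃ y₂ ⟩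
    x₁ * y₂ * y₃ ≤⟨ *-monoˡ-≤ y₃ u≤v ⟩
    x₂ * y₁ * y₃ ≡⟨ swap x₂ y₁ y₃ ⟩
    x₂ * y₃ * y₁ ≤⟨ *-monoˡ-≤ y₁ v≤w ⟩
    x₃ * y₂ * y₁ ≡⟨ swap x₃ y₂ y₁ ⟩
    x₃ * y₁ * y₂ ∎)
  where
  open ≤-Reasoning
  swap : ∀ a b c → a * b * c ≡ a * c * b
  swap = solve-∀

e⁻ : ℕ → ℕ × ℕ
e⁻ n = suc n ^ n , n ^ n

e⁺ : ℕ → ℕ × ℕ
e⁺ n = suc n ^ suc n , n ^ suc n

e⁻≤e⁺ : ∀ n → e⁻ n ≤ᶠ e⁺ n
e⁻≤e⁺ n = begin
  suc n ^ n * (n * n ^ n)     ≤⟨ *-monoʳ-≤ (suc n ^ n) (*-monoˡ-≤ (n ^ n) (n≤1+n n)) ⟩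
  suc n ^ n * (suc n * n ^ n) ≡⟨ rearrange (suc n) (suc n ^ n) (n ^ n) ⟩
  suc n * suc n ^ n * n ^ n   ∎
  where
  open ≤-Reasoning
  rearrange : ∀ s x y → x * (s * y) ≡ s * x * y
  rearrange = solve-∀

-- With a = n (n + 2) we have (n + 1)² = a + 1, so both steps are Bernoulli bounds on (1 + 1/a)^(n+1),
-- namely powGap-upper and powGap-lower.
e⁻-step : ∀ n → e⁻ n ≤ᶠ e⁻ (suc n)
e⁻-step zero    = s≤s z≤n
e⁻-step (suc p) = begin
  s ^ n * (s * s ^ n)  ≡⟨ square-pow s n ⟩
  s * (s * s) ^ n      ≡⟨ cong (λ x → s * x ^ n) (square p) ⟩
  s * suc a ^ n        ≤⟨ *-cancelˡ-≤ n (+-cancelʳ-≤ (s * suc a ^ n) _ _ (begin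
    n * (s * suc a ^ n) + s * suc a ^ n ≡⟨ expand p (suc a ^ n) ⟩
    suc a ^ s                           ≡⟨ suc^≡^+powGap a s ⟩
    a ^ s + powGap a s                  ≤⟨ +-monoʳ-≤ (a ^ s) (powGap-upper a n) ⟩
    n * t * a ^ n + s * suc a ^ n       ≡⟨ cong (_+ s * suc a ^ n) (*-assoc n t (a ^ n)) ⟩
    n * (t * a ^ n) + s * suc a ^ n     ∎)) ⟩
  t * a ^ n            ≡⟨ cong (t *_) (^-distrib-* n t n) ⟩
  t * (n ^ n * t ^ n)  ≡⟨ rearrange t (n ^ n) (t ^ n) ⟩
  t * t ^ n * n ^ n    ∎
  where
  open ≤-Reasoning
  n = suc p
  s = suc n
  t = suc s
  a = n * t
  square : ∀ p → suc (suc p) * suc (suc p) ≡ suc (suc p * suc (suc (suc p)))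
  square = solve-∀
  expand : ∀ p y → suc p * (suc (suc p) * y) + suc (suc p) * y ≡ suc (suc p * suc (suc (suc p))) * y
  expand = solve-∀
  square-pow : ∀ s n → s ^ n * (s * s ^ n) ≡ s * (s * s) ^ n
  square-pow s n = trans (rotate s (s ^ n)) (cong (s *_) (sym (^-distrib-* s s n)))
    where
    rotate : ∀ s x → x * (s * x) ≡ s * (x * x)
    rotate = solve-∀
  rearrange : ∀ t x y → t * (x * y) ≡ t * y * x
  rearrange = solve-∀

e⁺-step : ∀ n → e⁺ (suc n) ≤ᶠ e⁺ n
e⁺-step n = begin
  t * t ^ s * n ^ s     ≡⟨ *-assoc t (t ^ s) (n ^ s) ⟩
  t * (t ^ s * n ^ s)   ≡⟨ cong (t *_) (trans (*-comm (t ^ s) (n ^ s)) (sym (^-distrib-* n t s))) ⟩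
  t * (a * a ^ n)       ≡⟨ *-assoc t a (a ^ n) ⟨
  t * a * a ^ n         ≤⟨ *-monoˡ-≤ (a ^ n) (≤-trans (n≤1+n (t * a)) (≤-reflexive (almost n))) ⟩
  s * (a + s) * a ^ n   ≡⟨ rotate s (a + s) (a ^ n) ⟩
  s * (a ^ n * (a + s)) ≤⟨ *-monoʳ-≤ s (begin
    a ^ n * (a + s)       ≡⟨ expand a s (a ^ n) ⟩
    a ^ s + s * a ^ n     ≤⟨ +-monoʳ-≤ (a ^ s) (powGap-lower a n) ⟩
    a ^ s + powGap a s    ≡⟨ suc^≡^+powGap a s ⟨
    suc a ^ s             ∎) ⟩
  s * suc a ^ s         ≡⟨ cong (λ x → s * x ^ s) (square n) ⟩
  s * (s * s) ^ s       ≡⟨ cong (s *_) (^-distrib-* s s s) ⟩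
  s * (s ^ s * s ^ s)   ≡⟨ rotate′ s (s ^ s) ⟩
  s ^ s * (s * s ^ s)   ∎
  where
  open ≤-Reasoning
  s = suc n
  t = suc s
  a = n * t
  almost : ∀ n → suc (suc (suc n) * (n * suc (suc n))) ≡ suc n * (n * suc (suc n) + suc n)
  almost = solve-∀
  square : ∀ n → suc (n * suc (suc n)) ≡ suc n * suc n
  square = solve-∀
  expand : ∀ a s y → y * (a + s) ≡ a * y + s * y
  expand = solve-∀
  rotate : ∀ s b y → s * b * y ≡ s * (y * b)
  rotate = solve-∀
  rotate′ : ∀ s x → s * (x * x) ≡ x * (s * x)
  rotate′ = solve-∀

n^n>0 : ∀ n → 0 < n ^ n
n^n>0 zero    = s≤s z≤n
n^n>0 (suc n) = m^n>0 (suc n) (suc n)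

e⁻-mono : ∀ r n → e⁻ n ≤ᶠ e⁻ (r + n)
e⁻-mono zero    n = ≤-refl
e⁻-mono (suc r) n =
  ≤ᶠ-trans (e⁻ n) (e⁻ (r + n)) (e⁻ (suc r + n)) (n^n>0 (r + n)) (e⁻-mono r n) (e⁻-step (r + n))

e⁺-anti : ∀ r n → e⁺ (suc (r + n)) ≤ᶠ e⁺ (suc n)
e⁺-anti zero    n = ≤-refl
e⁺-anti (suc r) n = ≤ᶠ-trans (e⁺ (suc (suc r + n))) (e⁺ (suc (r + n))) (e⁺ (suc n))
  (m^n>0 (suc (r + n)) (suc (suc (r + n)))) (e⁺-step (suc (r + n))) (e⁺-anti r n)

e⁻≤ᶠe⁺ : ∀ N q → e⁻ N ≤ᶠ e⁺ q
e⁻≤ᶠe⁺ N zero    = ≤-trans (≤-reflexive (*-zeroʳ (suc N ^ N))) z≤n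
e⁻≤ᶠe⁺ N (suc p) = ≤ᶠ-trans (e⁻ N) (e⁻ M) (e⁺ (suc p)) (n^n>0 M) (e⁻-mono (suc p) N)
  (≤ᶠ-trans (e⁻ M) (e⁺ M) (e⁺ (suc p)) (m^n>0 M (suc M)) (e⁻≤e⁺ M)
    (subst (λ x → e⁺ (suc x) ≤ᶠ e⁺ (suc p)) (+-comm N p) (e⁺-anti N p)))
  where
  M = suc p + N

-- With x = q/(q+1), κ = r + c and δ = s + c: c (1 - x^κ) ≤ κ (1 - x^δ).
powGap-concave : ∀ q r s c →
  c * powGap q (r + c) * suc q ^ (s + c) ≤ (r + c) * powGap q (s + c) * suc q ^ (r + c)
powGap-concave q r s c = begin
  c * powGap q (r + c) * K ^ (s + c)           ≤⟨ *-monoˡ-≤ (K ^ (s + c)) (powGap-average q r c) ⟩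
  (r + c) * powGap q c * K ^ r * K ^ (s + c)   ≡⟨ *-assoc ((r + c) * powGap q c) (K ^ r) (K ^ (s + c)) ⟩
  (r + c) * powGap q c * (K ^ r * K ^ (s + c)) ≡⟨ cong ((r + c) * powGap q c *_) exchange ⟩
  (r + c) * powGap q c * (K ^ s * K ^ (r + c)) ≡⟨ regroup (r + c) (powGap q c) (K ^ s) (K ^ (r + c)) ⟩
  (r + c) * (K ^ s * powGap q c) * K ^ (r + c) ≤⟨ *-monoˡ-≤ (K ^ (r + c)) (*-monoʳ-≤ (r + c) shift) ⟩
  (r + c) * powGap q (s + c) * K ^ (r + c)     ∎
  where
  open ≤-Reasoning
  K = suc q
  exchange : K ^ r * K ^ (s + c) ≡ K ^ s * K ^ (r + c)
  exchange = trans (sym (^-distribˡ-+-* K r (s + c)))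
    (trans (cong (K ^_) (left-comm r s c)) (^-distribˡ-+-* K s (r + c)))
    where
    left-comm : ∀ r s c → r + (s + c) ≡ s + (r + c)
    left-comm = solve-∀
  regroup : ∀ x g y z → x * g * (y * z) ≡ x * (y * g) * z
  regroup = solve-∀
  shift : K ^ s * powGap q c ≤ powGap q (s + c)
  shift = ^*powGap≤powGap-+ q s c

oneMinusInvE≤powGap : ∀ N q → (suc N ^ N ∸ N ^ N) * suc q ^ suc q ≤ suc N ^ N * powGap q (suc q)
oneMinusInvE≤powGap N q = +-cancelʳ-≤ (N ^ N * K ^ K) _ _ (begin
  (A ∸ N ^ N) * K ^ K + N ^ N * K ^ K ≡⟨ *-distribʳ-+ (K ^ K) (A ∸ N ^ N) (N ^ N) ⟨
  (A ∸ N ^ N + N ^ N) * K ^ K         ≡⟨ cong (_* K ^ K) (m∸n+n≡m (^-monoˡ-≤ N (n≤1+n N))) ⟩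
  A * K ^ K                           ≡⟨ cong (A *_) (suc^≡^+powGap q K) ⟩
  A * (q ^ K + powGap q K)            ≡⟨ *-distribˡ-+ A (q ^ K) (powGap q K) ⟩
  A * q ^ K + A * powGap q K          ≤⟨ +-monoˡ-≤ (A * powGap q K) (e⁻≤ᶠe⁺ N q) ⟩
  K ^ K * N ^ N + A * powGap q K      ≡⟨ swap (K ^ K) (N ^ N) (A * powGap q K) ⟩
  A * powGap q K + N ^ N * K ^ K      ∎)
  where
  open ≤-Reasoning
  K = suc q
  A = suc N ^ N
  swap : ∀ x y z → x * y + z ≡ z + y * x
  swap = solve-∀

oneMinusInvE-min-bound : ∀ N q c d → c ≤ suc q → c ≤ d →
  (suc N ^ N ∸ N ^ N) * c * suc q ^ d ≤ suc N ^ N * (suc q * powGap q d)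
oneMinusInvE-min-bound N q c d c≤k c≤d = *-cancelʳ-≤ _ _ (K ^ K) {{m^n≢0 K K}} (begin
  D * c * K ^ d * K ^ K               ≡⟨ regroup D c (K ^ d) (K ^ K) ⟩
  D * K ^ K * (c * K ^ d)             ≤⟨ *-monoˡ-≤ (c * K ^ d) (oneMinusInvE≤powGap N q) ⟩
  A * powGap q K * (c * K ^ d)        ≡⟨ regroup′ A (powGap q K) c (K ^ d) ⟩
  A * (c * powGap q K * K ^ d)        ≤⟨ *-monoʳ-≤ A concave ⟩
  A * (K * powGap q d * K ^ K)        ≡⟨ *-assoc A (K * powGap q d) (K ^ K) ⟨
  A * (K * powGap q d) * K ^ K        ∎)
  where
  open ≤-Reasoning
  K = suc q
  A = suc N ^ N
  D = A ∸ N ^ N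
  concave : c * powGap q K * K ^ d ≤ K * powGap q d * K ^ K
  concave = subst₂ (λ κ δ → c * powGap q κ * K ^ δ ≤ κ * powGap q δ * K ^ κ)
    (m∸n+n≡m c≤k) (m∸n+n≡m c≤d) (powGap-concave q (K ∸ c) (d ∸ c) c)
  regroup : ∀ D c x y → D * c * x * y ≡ D * y * (c * x)
  regroup = solve-∀
  regroup′ : ∀ A g c x → A * g * (c * x) ≡ A * (c * g * x)
  regroup′ = solve-∀

-- Rescaling the rational greedy scores

ι : ℕ → ℚᵘ
ι x = mkℚᵘ (ℤ.+ x) 0

ι-+ : ∀ x y → ι (x + y) ≃ ι x ℚ.+ ι y
ι-+ x y = *≡* (cong (ℤ._* ℤ.+ 1)
  (trans (ℤ.pos-+ x y) (sym (cong₂ ℤ._+_ (ℤ.*-identityʳ (ℤ.+ x)) (ℤ.*-identityʳ (ℤ.+ y))))))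

ι-* : ∀ x y → ι (x * y) ≃ ι x ℚ.* ι y
ι-* x y = *≡* (cong (ℤ._* ℤ.+ 1) (ℤ.pos-* x y))

ι-≤⁻¹ : ∀ {x y} → ι x ℚ.≤ ι y → x ≤ y
ι-≤⁻¹ {x} {y} (*≤* x*1≤y*1) with subst₂ ℤ._≤_ (ℤ.*-identityʳ (ℤ.+ x)) (ℤ.*-identityʳ (ℤ.+ y)) x*1≤y*1
... | +≤+ x≤y = x≤y

oneMinusInv*ι≃ι : ∀ q → oneMinusInv (suc q) ℚ.* ι (suc q) ≃ ι q
oneMinusInv*ι≃ι q = *≡* (trans (ℤ.*-identityʳ _) (cong (λ d → ℤ.+ q ℤ.* ℤ.+ d) (sym (*-identityʳ (suc q)))))

oneMinusInv^*ι≃ι : ∀ q r e → (oneMinusInv (suc q) ^ℚ r) ℚ.* ι (suc q ^ (r + e)) ≃ ι (q ^ r * suc q ^ e)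
oneMinusInv^*ι≃ι q zero    e = ℚ.≃-trans (ℚ.*-identityˡ _) (ℚ.≃-reflexive (cong ι (sym (*-identityˡ _))))
oneMinusInv^*ι≃ι q (suc r) e = begin
  (ρ ℚ.* (ρ ^ℚ r)) ℚ.* ι (k * k ^ (r + e))       ≈⟨ ℚ.*-congˡ {ρ ℚ.* (ρ ^ℚ r)} (ι-* k (k ^ (r + e))) ⟩
  (ρ ℚ.* (ρ ^ℚ r)) ℚ.* (ι k ℚ.* ι (k ^ (r + e))) ≈⟨ ℚ-*-interchange ρ (ρ ^ℚ r) (ι k) (ι (k ^ (r + e))) ⟩
  (ρ ℚ.* ι k) ℚ.* ((ρ ^ℚ r) ℚ.* ι (k ^ (r + e))) ≈⟨ ℚ.*-cong (oneMinusInv*ι≃ι q) (oneMinusInv^*ι≃ι q r e) ⟩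
  ι q ℚ.* ι (q ^ r * k ^ e)                      ≈⟨ ι-* q (q ^ r * k ^ e) ⟨
  ι (q * (q ^ r * k ^ e))                        ≡⟨ cong ι (*-assoc q (q ^ r) (k ^ e)) ⟨
  ι (q * q ^ r * k ^ e)                          ∎
  where
  open ℚ.≃-Reasoning
  k = suc q
  ρ = oneMinusInv k

sumℚ-filter*≃ι : ∀ {A : Set ℓ} {P : Pred A ℓ′} (P? : Decidable P) (f : A → ℚᵘ) (g : A → ℕ) (c : ℚᵘ) →
  (∀ x → P x → f x ℚ.* c ≃ ι (g x)) →
  ∀ xs → sumℚ (map f (filter P? xs)) ℚ.* c ≃ ι (sumᴸ (map (λ x → 𝟙 (P? x) * g x) xs))
sumℚ-filter*≃ι P? f g c fc≃g []       = ℚ.*-zeroˡ c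
sumℚ-filter*≃ι P? f g c fc≃g (x ∷ xs) with P? x
... | no _  = sumℚ-filter*≃ι P? f g c fc≃g xs
... | yes px = begin
  (f x ℚ.+ sumℚ (map f (filter P? xs))) ℚ.* c      ≈⟨ ℚ.*-distribʳ-+ c (f x) (sumℚ (map f (filter P? xs))) ⟩
  f x ℚ.* c ℚ.+ sumℚ (map f (filter P? xs)) ℚ.* c  ≈⟨ ℚ.+-cong (fc≃g x px) (sumℚ-filter*≃ι P? f g c fc≃g xs) ⟩
  ι (g x) ℚ.+ ι rest                               ≈⟨ ι-+ (g x) rest ⟨
  ι (g x + rest)                                   ≡⟨ cong (λ y → ι (y + rest)) (*-identityˡ (g x)) ⟨
  ι (1 * g x + rest)                               ∎
  where
  open ℚ.≃-Reasoning
  rest = sumᴸ (map (λ x → 𝟙 (P? x) * g x) xs)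

-- Coverage of a fixed family of sets

module SetFamily {m n : ℕ} (Ss : Fin n → Subset m) where

  present : Fin m → Fin n → ℕ
  present v j = 𝟙 (v ∈? Ss j)

  absent : Fin m → Fin n → ℕ
  absent v j = 𝟙 (¬? (v ∈? Ss j))

  degree : Fin m → ℕ
  degree v = ∑[ j < n ] present v j

  missing : Fin m → ℕ
  missing v = ∑[ j < n ] absent v j

  degree+missing≡n : ∀ v → degree v + missing v ≡ n
  degree+missing≡n v = begin
    degree v + missing v                   ≡⟨ ∑-distrib-+ (present v) (absent v) ⟨
    ∑[ j < n ] (present v j + absent v j)  ≡⟨ sum-cong-≗ (λ j → 𝟙-+-𝟙-¬ (v ∈? Ss j)) ⟩
    ∑[ j < n ] 1                           ≡⟨ trans (sum-const n 1) (*-identityʳ n) ⟩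
    n                                      ∎
    where open ≡-Reasoning

  module _ {k : ℕ} (b : Fin n → Fin k) where

    covers : Fin m → ℕ
    covers v = ∑[ i < k ] 𝟙 (v ∈? coverUnion Ss b i)

    coverage≡∑covers : coverage Ss b ≡ ∑[ v < m ] covers v
    coverage≡∑covers = begin
      sumᴸ (map (λ i → ∣ U i ∣) (allFin k))   ≡⟨ sumᴸ-allFin (λ i → ∣ U i ∣) ⟩
      ∑[ i < k ] ∣ U i ∣                       ≡⟨ sum-cong-≗ (λ i → ∣p∣≡sum𝟙∈ (U i)) ⟩
      ∑[ i < k ] ∑[ v < m ] 𝟙 (v ∈? U i)      ≡⟨ ∑-comm (λ i v → 𝟙 (v ∈? U i)) ⟩
      ∑[ v < m ] covers v                      ∎
      where
      open ≡-Reasoning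
      U = coverUnion Ss b

    covers≤k : ∀ v → covers v ≤ k
    covers≤k v = begin
      covers v      ≤⟨ sum-mono-≤ (λ i → 𝟙≤1 (v ∈? coverUnion Ss b i)) ⟩
      ∑[ i < k ] 1  ≡⟨ trans (sum-const k 1) (*-identityʳ k) ⟩
      k             ∎
      where open ≤-Reasoning

    covers≤degree : ∀ v → covers v ≤ degree v
    covers≤degree v = begin
      covers v                                           ≤⟨ sum-mono-≤ (λ i → 𝟙∈⋃-filter≤multiplicity Ss (λ j → b j Fin.≟ i) v) ⟩
      ∑[ i < k ] ∑[ j < n ] (𝟙 (b j Fin.≟ i) * present v j) ≡⟨ ∑-comm (λ i j → 𝟙 (b j Fin.≟ i) * present v j) ⟩
      ∑[ j < n ] ∑[ i < k ] (𝟙 (b j Fin.≟ i) * present v j) ≡⟨ sum-cong-≗ (λ j → sum-δ (b j) (λ _ → present v j)) ⟩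
      degree v                                           ∎
      where open ≤-Reasoning

  -- k^n times the expected coverage when every S_j is put into a uniformly random one of the k covers:
  -- v then lies in k (1 - (1 - 1/k)^(degree v)) covers on average.
  randomCoverage : ℕ → ℕ
  randomCoverage q = ∑[ v < m ] (suc q * powGap q (degree v) * suc q ^ missing v)

  coverage≤randomCoverage : ∀ N q (b : Fin n → Fin (suc q)) →
    (suc N ^ N ∸ N ^ N) * coverage Ss b * suc q ^ n ≤ suc N ^ N * randomCoverage q
  coverage≤randomCoverage N q b = begin
    D * coverage Ss b * k ^ n            ≡⟨ cong (λ c → D * c * k ^ n) (coverage≡∑covers b) ⟩
    D * ∑[ v < m ] covers b v * k ^ n    ≡⟨ cong (_* k ^ n) (*-distribˡ-sum D (covers b)) ⟩
    ∑[ v < m ] (D * covers b v) * k ^ n  ≡⟨ *-distribʳ-sum (k ^ n) (λ v → D * covers b v) ⟩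
    ∑[ v < m ] (D * covers b v * k ^ n)  ≤⟨ sum-mono-≤ per-element ⟩
    ∑[ v < m ] (A * random v)            ≡⟨ *-distribˡ-sum A random ⟨
    A * randomCoverage q                 ∎
    where
    open ≤-Reasoning
    k = suc q
    A = suc N ^ N
    D = A ∸ N ^ N
    random : Fin m → ℕ
    random v = k * powGap q (degree v) * k ^ missing v
    per-element : ∀ v → D * covers b v * k ^ n ≤ A * random v
    per-element v = begin
      D * c * k ^ n                ≡⟨ cong (λ e → D * c * k ^ e) (degree+missing≡n v) ⟨
      D * c * k ^ (d + e)          ≡⟨ cong (D * c *_) (^-distribˡ-+-* k d e) ⟩
      D * c * (k ^ d * k ^ e)      ≡⟨ *-assoc (D * c) (k ^ d) (k ^ e) ⟨
      D * c * k ^ d * k ^ e        ≤⟨ *-monoˡ-≤ (k ^ e) (oneMinusInvE-min-bound N q c d (covers≤k b v) (covers≤degree b v)) ⟩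
      A * (k * powGap q d) * k ^ e ≡⟨ *-assoc A (k * powGap q d) (k ^ e) ⟩
      A * random v                 ∎
      where
      c = covers b v
      d = degree v
      e = missing v

  module Greedy (q : ℕ) (a : Fin n → Fin (suc q)) where

    k : ℕ
    k = suc q

    assigned : Fin n → Fin k → ℕ
    assigned j i = 𝟙 (a j Fin.≟ i)

    -- weight t v = k^(n-t) (1 - 1/k)^#{j ≥ t | v ∈ S_j}, so potential t / k^(n-t) is the expected number of
    -- pairs (v , i) with v ∉ c_i at the end when the sets S_j with j ≥ t (counting from 0) are put into
    -- uniformly random covers.
    weight : ℕ → Fin m → ℕ
    weight t v = q ^ sum≥ t (present v) * k ^ sum≥ t (absent v)

    hits : ℕ → Fin m → Fin k → ℕ
    hits t v i = sum< t (λ j → assigned j i * present v j)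

    uncovered : ℕ → Fin m → Fin k → ℕ
    uncovered t v i = 𝟙 (hits t v i ≟ 0)

    potential : ℕ → ℕ
    potential t = ∑[ v < m ] ∑[ i < k ] (uncovered t v i * weight t v)

    contribution : Fin n → Fin m → Fin k → ℕ
    contribution j v i = present v j * uncovered (toℕ j) v i * weight (suc (toℕ j)) v

    gain : Fin n → Fin k → ℕ
    gain j i = ∑[ v < m ] contribution j v i

    later : Fin n → ℕ
    later j = sum≥ (suc (toℕ j)) (λ (_ : Fin n) → 1)

    later≡present+absent : ∀ j v → later j ≡ sum≥ (suc (toℕ j)) (present v) + sum≥ (suc (toℕ j)) (absent v)
    later≡present+absent j v =
      trans (sum-cong-≗ split) (∑-distrib-+ (λ j′ → after j′ * present v j′) (λ j′ → after j′ * absent v j′))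
      where
      after : Fin n → ℕ
      after j′ = 𝟙 (suc (toℕ j) ≤? toℕ j′)
      split : ∀ j′ → after j′ * 1 ≡ after j′ * present v j′ + after j′ * absent v j′
      split j′ = trans (cong (after j′ *_) (sym (𝟙-+-𝟙-¬ (v ∈? Ss j′))))
                       (*-distribˡ-+ (after j′) (present v j′) (absent v j′))

    yv≡suc-later : ∀ j v → v ∈ Ss j → yv Ss j v ≡ suc (sum≥ (suc (toℕ j)) (present v))
    yv≡suc-later j v v∈ = begin
      yv Ss j v                          ≡⟨ length-filter≡sum𝟙 P? (allFin n) ⟩
      sumᴸ (map (𝟙 ∘ P?) (allFin n))      ≡⟨ sumᴸ-allFin (𝟙 ∘ P?) ⟩
      ∑[ j′ < n ] 𝟙 (P? j′)               ≡⟨ sum-cong-≗ (λ j′ → 𝟙-× (j Fin.≤? j′) (v ∈? Ss j′)) ⟩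
      sum≥ (toℕ j) (present v)            ≡⟨ sum≥-split j (present v) ⟩
      present v j + rest                  ≡⟨ cong (_+ rest) (𝟙-yes (v ∈? Ss j) v∈) ⟩
      suc rest                            ∎
      where
      open ≡-Reasoning
      P? = λ j′ → (j Fin.≤? j′) ×-dec (v ∈? Ss j′)
      rest = sum≥ (suc (toℕ j)) (present v)

    𝟙∉partialCoverUnion≡uncovered : ∀ j v i → 𝟙 (¬? (v ∈? partialCoverUnion Ss a j i)) ≡ uncovered (toℕ j) v i
    𝟙∉partialCoverUnion≡uncovered j v i =
      trans (𝟙∉⋃-filter≡𝟙multiplicity≡0 Ss P? v) (cong (λ h → 𝟙 (h ≟ 0)) (sum-cong-≗ regroup))
      where
      P? = λ j′ → (j′ Fin.<? j) ×-dec (a j′ Fin.≟ i)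
      regroup : ∀ j′ → 𝟙 (P? j′) * present v j′ ≡ 𝟙 (j′ Fin.<? j) * (assigned j′ i * present v j′)
      regroup j′ = trans (cong (_* present v j′) (𝟙-× (j′ Fin.<? j) (a j′ Fin.≟ i)))
                         (*-assoc (𝟙 (j′ Fin.<? j)) (assigned j′ i) (present v j′))

    greedyGain*kˡᵃᵗᵉʳ≃gain : ∀ j i → greedyGain k Ss a j i ℚ.* ι (k ^ later j) ≃ ι (gain j i)
    greedyGain*kˡᵃᵗᵉʳ≃gain j i = ℚ.≃-trans
      (sumℚ-filter*≃ι P? (λ v → oneMinusInv k ^ℚ (yv Ss j v ∸ 1)) w′ (ι (k ^ later j)) scaled (allFin m))
      (ℚ.≃-reflexive (cong ι (trans (sumᴸ-allFin (λ v → 𝟙 (P? v) * w′ v)) (sum-cong-≗ {m} selected))))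
      where
      w′ = weight (suc (toℕ j))
      P? = λ v → (v ∈? Ss j) ×-dec ¬? (v ∈? partialCoverUnion Ss a j i)
      scaled : ∀ v → v ∈ Ss j × v ∉ partialCoverUnion Ss a j i →
        (oneMinusInv k ^ℚ (yv Ss j v ∸ 1)) ℚ.* ι (k ^ later j) ≃ ι (w′ v)
      scaled v (v∈ , _) = subst₂ (λ r l → (oneMinusInv k ^ℚ r) ℚ.* ι (k ^ l) ≃ ι (w′ v))
        (cong (_∸ 1) (sym (yv≡suc-later j v v∈))) (sym (later≡present+absent j v))
        (oneMinusInv^*ι≃ι q (sum≥ (suc (toℕ j)) (present v)) (sum≥ (suc (toℕ j)) (absent v)))
      selected : ∀ v → 𝟙 (P? v) * w′ v ≡ contribution j v i
      selected v = cong (_* w′ v) (trans (𝟙-× (v ∈? Ss j) (¬? (v ∈? partialCoverUnion Ss a j i)))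
                                         (cong (present v j *_) (𝟙∉partialCoverUnion≡uncovered j v i)))

    greedy⇒gain≤ : IsGreedyOutcome k Ss a → ∀ j i → gain j i ≤ gain j (a j)
    greedy⇒gain≤ greedy j i = ι-≤⁻¹
      (ℚ.≤-respˡ-≃ (greedyGain*kˡᵃᵗᵉʳ≃gain j i) (ℚ.≤-respʳ-≃ (greedyGain*kˡᵃᵗᵉʳ≃gain j (a j))
        (ℚ.*-monoˡ-≤-nonNeg (ι (k ^ later j)) (greedy j i))))

    weight-split : ∀ j v → weight (toℕ j) v ≡ q ^ present v j * k ^ absent v j * weight (suc (toℕ j)) v
    weight-split j v = begin
      q ^ sum≥ t (present v) * k ^ sum≥ t (absent v)
        ≡⟨ cong₂ (λ x y → q ^ x * k ^ y) (sum≥-split j (present v)) (sum≥-split j (absent v)) ⟩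
      q ^ (present v j + P′) * k ^ (absent v j + A′)
        ≡⟨ cong₂ _*_ (^-distribˡ-+-* q (present v j) P′) (^-distribˡ-+-* k (absent v j) A′) ⟩
      q ^ present v j * q ^ P′ * (k ^ absent v j * k ^ A′)
        ≡⟨ interchange (q ^ present v j) (q ^ P′) (k ^ absent v j) (k ^ A′) ⟩
      q ^ present v j * k ^ absent v j * weight (suc t) v
        ∎
      where
      open ≡-Reasoning
      t = toℕ j
      P′ = sum≥ (suc t) (present v)
      A′ = sum≥ (suc t) (absent v)
      interchange : ∀ a b c d → a * b * (c * d) ≡ a * c * (b * d)
      interchange = solve-∀

    uncovered-step : ∀ j v i →
      uncovered (suc (toℕ j)) v i + assigned j i * present v j * uncovered (toℕ j) v i ≡ uncovered (toℕ j) v i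
    uncovered-step j v i = begin
      𝟙 (hits (suc (toℕ j)) v i ≟ 0) + b * uncovered (toℕ j) v i
        ≡⟨ cong (λ h → 𝟙 (h ≟ 0) + b * uncovered (toℕ j) v i) (sum<-split j (λ j′ → assigned j′ i * present v j′)) ⟩
      𝟙 (b + hits (toℕ j) v i ≟ 0) + b * uncovered (toℕ j) v i
        ≡⟨ 𝟙[b+c≡0]+b*𝟙[c≡0] b (hits (toℕ j) v i) (*-mono-≤ (𝟙≤1 (a j Fin.≟ i)) (𝟙≤1 (v ∈? Ss j))) ⟩
      uncovered (toℕ j) v i
        ∎
      where
      open ≡-Reasoning
      b = assigned j i * present v j

    potential-step-pointwise : ∀ j v i →
      k * (uncovered (suc (toℕ j)) v i * weight (suc (toℕ j)) v + assigned j i * contribution j v i)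
        ≡ uncovered (toℕ j) v i * weight (toℕ j) v + contribution j v i
    potential-step-pointwise j v i = begin
      k * (z′ * w′ + δ * (p * z * w′))       ≡⟨ collect k z′ w′ δ p z ⟩
      k * w′ * (z′ + δ * p * z)              ≡⟨ cong (k * w′ *_) (uncovered-step j v i) ⟩
      k * w′ * z                             ≡⟨ cong (λ x → x * w′ * z) (^𝟙*suc^𝟙¬+𝟙 q (v ∈? Ss j)) ⟨
      (q ^ p * k ^ p̄ + p) * w′ * z           ≡⟨ expand (q ^ p * k ^ p̄) p w′ z ⟩
      z * (q ^ p * k ^ p̄ * w′) + p * z * w′  ≡⟨ cong (λ x → z * x + p * z * w′) (weight-split j v) ⟨
      z * weight (toℕ j) v + p * z * w′      ∎
      where
      open ≡-Reasoning
      z′ = uncovered (suc (toℕ j)) v i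
      z  = uncovered (toℕ j) v i
      w′ = weight (suc (toℕ j)) v
      δ  = assigned j i
      p  = present v j
      p̄  = absent v j
      collect : ∀ k z′ w′ δ p z → k * (z′ * w′ + δ * (p * z * w′)) ≡ k * w′ * (z′ + δ * p * z)
      collect = solve-∀
      expand : ∀ x p w′ z → (x + p) * w′ * z ≡ z * (x * w′) + p * z * w′
      expand = solve-∀

    potential-step : ∀ j → k * (potential (suc (toℕ j)) + gain j (a j)) ≡ potential (toℕ j) + ∑[ i < k ] gain j i
    potential-step j = begin
      k * (potential t′ + gain j (a j))
        ≡⟨ cong (λ g → k * (potential t′ + g)) (sum-cong-≗ (λ v → sum-δ (a j) (contribution j v))) ⟨
      k * (potential t′ + ∑[ v < m ] ∑[ i < k ] chosen v i)
        ≡⟨ cong (k *_) (∑∑-distrib-+ after chosen) ⟨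
      k * ∑[ v < m ] ∑[ i < k ] (after v i + chosen v i)
        ≡⟨ *-distribˡ-∑∑ k (λ v i → after v i + chosen v i) ⟩
      ∑[ v < m ] ∑[ i < k ] (k * (after v i + chosen v i))
        ≡⟨ sum-cong-≗ (λ v → sum-cong-≗ (potential-step-pointwise j v)) ⟩
      ∑[ v < m ] ∑[ i < k ] (uncovered t v i * weight t v + contribution j v i)
        ≡⟨ ∑∑-distrib-+ (λ v i → uncovered t v i * weight t v) (contribution j) ⟩
      potential t + ∑[ v < m ] ∑[ i < k ] contribution j v i
        ≡⟨ cong (potential t +_) (∑-comm (contribution j)) ⟩
      potential t + ∑[ i < k ] gain j i
        ∎
      where
      open ≡-Reasoning
      t  = toℕ j
      t′ = suc t
      after : Fin m → Fin k → ℕ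
      after v i = uncovered t′ v i * weight t′ v
      chosen : Fin m → Fin k → ℕ
      chosen v i = assigned j i * contribution j v i

    potential-decay : (∀ j i → gain j i ≤ gain j (a j)) → k ^ n * potential n ≤ potential 0
    potential-decay greedy = pow-contraction k potential n λ t t<n →
      subst (λ s → k * potential (suc s) ≤ potential s) (Fin.toℕ-fromℕ< t<n)
        (≤-by-averaging _ _ _ (gain (fromℕ< t<n)) (potential-step (fromℕ< t<n)) (greedy (fromℕ< t<n)))

    potential-initial : potential 0 ≡ ∑[ v < m ] (k * (q ^ degree v * k ^ missing v))
    potential-initial = sum-cong-≗ λ v → begin
      ∑[ i < k ] (uncovered 0 v i * weight 0 v)      ≡⟨ sum-cong-≗ (initially v) ⟩
      ∑[ i < k ] (1 * (q ^ degree v * k ^ missing v)) ≡⟨ sum-cong-≗ {k} (λ _ → *-identityˡ (q ^ degree v * k ^ missing v)) ⟩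
      ∑[ i < k ] (q ^ degree v * k ^ missing v)      ≡⟨ sum-const k (q ^ degree v * k ^ missing v) ⟩
      k * (q ^ degree v * k ^ missing v)             ∎
      where
      open ≡-Reasoning
      initially : ∀ v i → uncovered 0 v i * weight 0 v ≡ 1 * (q ^ degree v * k ^ missing v)
      initially v i = cong₂ (λ h w → 𝟙 (h ≟ 0) * w) (sum<-zero (λ j → assigned j i * present v j))
                            (cong₂ (λ d e → q ^ d * k ^ e) (sum≥-zero (present v)) (sum≥-zero (absent v)))

    potential-final : potential n ≡ ∑[ v < m ] ∑[ i < k ] uncovered n v i
    potential-final = sum-cong-≗ λ v → sum-cong-≗ λ i →
      trans (cong₂ (λ d e → uncovered n v i * (q ^ d * k ^ e)) (sum≥-n (present v)) (sum≥-n (absent v)))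
            (*-identityʳ (uncovered n v i))

    covered+uncovered≡1 : ∀ v i → 𝟙 (v ∈? coverUnion Ss a i) + uncovered n v i ≡ 1
    covered+uncovered≡1 v i = begin
      𝟙 (v ∈? U) + uncovered n v i                                ≡⟨ cong (λ h → 𝟙 (v ∈? U) + 𝟙 (h ≟ 0)) all-placed ⟩
      𝟙 (v ∈? U) + 𝟙 (multiplicity Ss (λ j → a j Fin.≟ i) v ≟ 0)  ≡⟨ cong (𝟙 (v ∈? U) +_) not-in-union ⟨
      𝟙 (v ∈? U) + 𝟙 (¬? (v ∈? U))                                ≡⟨ 𝟙-+-𝟙-¬ (v ∈? U) ⟩
      1                                                           ∎
      where
      open ≡-Reasoning
      U = coverUnion Ss a i
      all-placed = sum<-n (λ j → assigned j i * present v j)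
      not-in-union = 𝟙∉⋃-filter≡𝟙multiplicity≡0 Ss (λ j → a j Fin.≟ i) v

    coverage+potential-final : coverage Ss a + potential n ≡ ∑[ v < m ] ∑[ i < k ] 1
    coverage+potential-final = begin
      coverage Ss a + potential n
        ≡⟨ cong₂ _+_ (coverage≡∑covers a) potential-final ⟩
      ∑[ v < m ] covers a v + ∑[ v < m ] ∑[ i < k ] uncovered n v i
        ≡⟨ ∑∑-distrib-+ (λ v i → 𝟙 (v ∈? coverUnion Ss a i)) (uncovered n) ⟨
      ∑[ v < m ] ∑[ i < k ] (𝟙 (v ∈? coverUnion Ss a i) + uncovered n v i)
        ≡⟨ sum-cong-≗ (λ v → sum-cong-≗ (covered+uncovered≡1 v)) ⟩
      ∑[ v < m ] ∑[ i < k ] 1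
        ∎
      where open ≡-Reasoning

    potential-initial+randomCoverage : potential 0 + randomCoverage q ≡ k ^ n * ∑[ v < m ] ∑[ i < k ] 1
    potential-initial+randomCoverage = begin
      potential 0 + randomCoverage q
        ≡⟨ cong (_+ randomCoverage q) potential-initial ⟩
      ∑[ v < m ] (k * (q ^ degree v * k ^ missing v)) + randomCoverage q
        ≡⟨ ∑-distrib-+ (λ v → k * (q ^ degree v * k ^ missing v)) (λ v → k * powGap q (degree v) * k ^ missing v) ⟨
      ∑[ v < m ] (k * (q ^ degree v * k ^ missing v) + k * powGap q (degree v) * k ^ missing v)
        ≡⟨ sum-cong-≗ per-element ⟩
      ∑[ v < m ] (k ^ n * ∑[ i < k ] 1)
        ≡⟨ *-distribˡ-sum {m} (k ^ n) (λ _ → ∑[ i < k ] 1) ⟨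
      k ^ n * ∑[ v < m ] ∑[ i < k ] 1
        ∎
      where
      open ≡-Reasoning
      per-element : ∀ v → k * (q ^ degree v * k ^ missing v) + k * powGap q (degree v) * k ^ missing v
                            ≡ k ^ n * ∑[ i < k ] 1
      per-element v = begin
        k * (q ^ d * k ^ e) + k * powGap q d * k ^ e  ≡⟨ collect k (q ^ d) (powGap q d) (k ^ e) ⟩
        k * ((q ^ d + powGap q d) * k ^ e)            ≡⟨ cong (λ x → k * (x * k ^ e)) (suc^≡^+powGap q d) ⟨
        k * (k ^ d * k ^ e)                           ≡⟨ cong (k *_) (^-distribˡ-+-* k d e) ⟨
        k * k ^ (d + e)                               ≡⟨ cong (λ x → k * k ^ x) (degree+missing≡n v) ⟩
        k * k ^ n                                     ≡⟨ *-comm k (k ^ n) ⟩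
        k ^ n * k                                     ≡⟨ cong (k ^ n *_) (trans (sum-const k 1) (*-identityʳ k)) ⟨
        k ^ n * ∑[ i < k ] 1                          ∎
        where
        d = degree v
        e = missing v
        collect : ∀ k x g y → k * (x * y) + k * g * y ≡ k * ((x + g) * y)
        collect = solve-∀

    randomCoverage≤coverage : IsGreedyOutcome k Ss a → randomCoverage q ≤ k ^ n * coverage Ss a
    randomCoverage≤coverage greedy = +-cancelʳ-≤ (k ^ n * potential n) _ _ (begin
      randomCoverage q + k ^ n * potential n       ≤⟨ +-monoʳ-≤ (randomCoverage q) decay ⟩
      randomCoverage q + potential 0               ≡⟨ +-comm (randomCoverage q) (potential 0) ⟩
      potential 0 + randomCoverage q               ≡⟨ potential-initial+randomCoverage ⟩
      k ^ n * ∑[ v < m ] ∑[ i < k ] 1              ≡⟨ cong (k ^ n *_) coverage+potential-final ⟨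
      k ^ n * (coverage Ss a + potential n)        ≡⟨ *-distribˡ-+ (k ^ n) (coverage Ss a) (potential n) ⟩
      k ^ n * coverage Ss a + k ^ n * potential n  ∎)
      where
      open ≤-Reasoning
      decay : k ^ n * potential n ≤ potential 0
      decay = potential-decay (greedy⇒gain≤ greedy)

theorem3 : (m n k : ℕ) → 2 ≤ k → (Ss : Fin n → Subset m) → (a : Fin n → Fin k) → IsGreedyOutcome k Ss a → (opt : Fin n → Fin k) → AtLeastOneMinusInvETimes (coverage Ss a) (coverage Ss opt)
theorem3 m n (suc q) (s≤s _) Ss a greedy opt N = *-cancelʳ-≤ _ _ (k ^ n) {{m^n≢0 k n}} (begin
  (suc N ^ N ∸ N ^ N) * coverage Ss opt * k ^ n  ≤⟨ coverage≤randomCoverage N q opt ⟩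
  suc N ^ N * randomCoverage q                   ≤⟨ *-monoʳ-≤ (suc N ^ N) (randomCoverage≤coverage greedy) ⟩
  suc N ^ N * (k ^ n * coverage Ss a)            ≡⟨ cong (suc N ^ N *_) (*-comm (k ^ n) (coverage Ss a)) ⟩
  suc N ^ N * (coverage Ss a * k ^ n)            ≡⟨ *-assoc (suc N ^ N) (coverage Ss a) (k ^ n) ⟨
  suc N ^ N * coverage Ss a * k ^ n              ∎)
  where
  open ≤-Reasoning
  open SetFamily Ss
  open Greedy q a
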